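{- Let $m\ge 2$, let $\mu_m$ be a cyclic group of order $m$ (written multiplicatively) with a fixed generator $\zeta$, and let $M$ be an acyclic $(\mathbb{Z}/m)[\mu_m]$-module. Let $\Phi:M\to\mathbb{Z}/m$ be a $(\mathbb{Z}/m)[\mu_m]$-module homomorphism, where $\mathbb{Z}/m$ carries the trivial $\mu_m$-action. Then there is a well-defined $(\mathbb{Z}/m)[\mu_m]$-module homomorphism $\hat\Phi:(1-[\zeta])M\to\mu_m$ (with $\mu_m$ carrying the trivial $\mu_m$-action) given by $$\hat\Phi\big((1-[\zeta])a\big)=\zeta^{\Phi(a)},\qquad a\in M,$$ and $\hat\Phi$ is independent of the choice of the generator $\zeta$.
   Context: For an element $\xi\in\mu_m$ write $[\xi]$ for the corresponding element of the group ring $(\mathbb{Z}/m)[\mu_m]$, and $[\mu_m]=\sum_{\xi\in\mu_m}[\xi]$. A $(\mathbb{Z}/m)[\mu_m]$-module $M$ is called acyclic if the complex $$M\xrightarrow{[\mu_m]}M\xrightarrow{1-[\zeta]}M\xrightarrow{[\mu_m]}M$$ is exact (at the two middle terms), i.e. its Tate cohomology $\hat H^\bullet(\mu_m,M)$ vanishes. -}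

module Defs where

open import Level using (Level; _⊔_) renaming (suc to lsuc)
open import Algebra.Bundles using (AbelianGroup)
open import Data.Nat using (ℕ; zero; suc)
open import Data.Integer using (ℤ; +_; _-_; _+_; _*_)
open import Data.Integer.Divisibility using () renaming (_∣_ to _∣ℤ_)
open import Data.Product using (Σ; ∃; _×_; _,_; proj₁)

-- Z/m is modelled as ℤ with congruence modulo m.
Congr : ℕ → ℤ → ℤ → Set
Congr m a b = (+ m) ∣ℤ (a - b)

iter : ∀ {a} {A : Set a} → ℕ → (A → A) → A → A
iter zero    f x = x
iter (suc n) f x = f (iter n f x)

times : ∀ {a} {A : Set a} → (A → A → A) → A → ℕ → A → A
times _∙_ e zero    x = e
times _∙_ e (suc n) x = x ∙ times _∙_ e n x

-- μ_m is modelled as the cyclic group Z/m (written additively): the element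
-- k ∈ Z/m corresponds to ζ₀^k for an (arbitrary) reference generator ζ₀.
-- A (Z/m)[μ_m]-module is an abelian group killed by m together with the
-- action τ of the reference generator ζ₀: a group endomorphism with τ^m = id.
record ZmCmModule (m : ℕ) (c ℓ : Level) : Set (lsuc (c ⊔ ℓ)) where
  field
    grp : AbelianGroup c ℓ
  open AbelianGroup grp public
  field
    τ         : Carrier → Carrier
    τ-cong    : ∀ {x y} → x ≈ y → τ x ≈ τ y
    τ-hom     : ∀ x y → τ (x ∙ y) ≈ τ x ∙ τ y
    τ-order   : ∀ x → iter m τ x ≈ x
    m-torsion : ∀ x → times _∙_ ε m x ≈ ε

  _·_ : ℕ → Carrier → Carrier
  n · x = times _∙_ ε n x

  act : ℕ → Carrier → Carrier
  act k = iter k τ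

  normSum : ℕ → Carrier → Carrier
  normSum zero    x = ε
  normSum (suc k) x = normSum k x ∙ act k x

  N : Carrier → Carrier
  N = normSum m

  -- the element 1 - [ζ] where ζ = ζ₀^g
  oneMinus : ℕ → Carrier → Carrier
  oneMinus g x = x ∙ (act g x) ⁻¹

module _ {m : ℕ} {c ℓ : Level} (M : ZmCmModule m c ℓ) where
  open ZmCmModule M

  -- acyclicity of M w.r.t. the generator ζ = ζ₀^g:
  -- exactness of  M --[μ_m]--> M --(1-[ζ])--> M --[μ_m]--> M  at the middle terms
  Acyclic : ℕ → Set (c ⊔ ℓ)
  Acyclic g = (∀ x → oneMinus g x ≈ ε → ∃ λ y → x ≈ N y)
            × (∀ x → N x ≈ ε → ∃ λ y → x ≈ oneMinus g y)

  record TrivHom : Set (c ⊔ ℓ) where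
    field
      Φ        : Carrier → ℤ
      Φ-cong   : ∀ {x y} → x ≈ y → Congr m (Φ x) (Φ y)
      Φ-hom    : ∀ x y → Congr m (Φ (x ∙ y)) (Φ x + Φ y)
      Φ-scalar : ∀ (k : ℕ) x → Congr m (Φ (k · x)) (+ k * Φ x)
      Φ-equiv  : ∀ x → Congr m (Φ (τ x)) (Φ x)

  Image : ℕ → Set (c ⊔ ℓ)
  Image g = Σ Carrier λ x → ∃ λ a → x ≈ oneMinus g a

  -- Ψ : (1-[ζ])M → μ_m ≅ Z/m is a well-defined (Z/m)[μ_m]-module homomorphism
  -- (μ_m with trivial action, written additively as exponents of ζ₀)
  record IsModHom (g : ℕ) (Ψ : Image g → ℤ) : Set (c ⊔ ℓ) where
    field
      wd     : ∀ (p q : Image g) → proj₁ p ≈ proj₁ q → Congr m (Ψ p) (Ψ q)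
      hom    : ∀ (p q r : Image g) → proj₁ r ≈ proj₁ p ∙ proj₁ q
               → Congr m (Ψ r) (Ψ p + Ψ q)
      scalar : ∀ (k : ℕ) (p r : Image g) → proj₁ r ≈ k · proj₁ p
               → Congr m (Ψ r) (+ k * Ψ p)
      equiv  : ∀ (p r : Image g) → proj₁ r ≈ τ (proj₁ p) → Congr m (Ψ r) (Ψ p)

{-# OPTIONS --safe #-}
-- With ζ = ζ₀^g, set Φ̂ ((1 - [ζ]) a) := g Φ(a), the exponent of ζ^Φ(a) = ζ₀^(g Φ(a)).
-- Two preimages of one element differ by a fixed point of ζ, which by acyclicity is
-- a norm N y, and Φ (N y) = m Φ(y) = 0; so Φ̂ is well defined, and it inherits
-- linearity and equivariance from Φ. For another generator ζ′ = ζ₀^g′ choose H with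
-- H g′ ≡ g (mod m) by Bézout, so ζ = ζ′^H: then (1 - [ζ]) a = (1 - [ζ′]) (Σ_{i<H} ζ′^i a),
-- hence the two images coincide and g′ Φ(Σ_{i<H} ζ′^i a) = g′ H Φ(a) = g Φ(a).
module Submission where

open import Defs
open import Level using (Level)
open import Data.Nat using (ℕ; _≤_)
open import Data.Nat.Coprimality using (Coprime)
open import Data.Integer using (ℤ; +_; _*_)
open import Data.Product using (Σ; ∃; _×_; _,_; proj₁)

import Data.Nat as ℕ
import Data.Nat.Properties as ℕ
import Data.Nat.Tactic.RingSolver as ℕ-Solver
import Data.Integer as ℤ
import Data.Integer.Properties as ℤ
import Data.Integer.Divisibility.Signed as Signed
open import Data.Integer.Tactic.RingSolver using (solve-∀)
open import Data.Nat.Coprimality using (coprime-Bézout)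
open import Data.Nat.GCD using (module Bézout)
open import Relation.Binary.Bundles using (Setoid)
open import Relation.Binary.Structures using (IsEquivalence)
open import Relation.Binary.PropositionalEquality as ≡ using (_≡_)
open import Relation.Nullary using (contradiction)

-- Congruences in ℕ

infix 4 _≡_mod_

record _≡_mod_ (n n′ m : ℕ) : Set where
  constructor witness
  field
    quotient quotient′ : ℕ
    equation : n ℕ.+ quotient ℕ.* m ≡ n′ ℕ.+ quotient′ ℕ.* m

≡⇒≡-mod : ∀ {n n′} m → n ≡ n′ → n ≡ n′ mod m
≡⇒≡-mod _ ≡.refl = witness 0 0 ≡.refl

coprime⇒solvable : ∀ {a m} → Coprime a m → ∀ b → ∃ λ H → H ℕ.* a ≡ b mod m
coprime⇒solvable {a} {m} a⊥m b with coprime-Bézout a⊥m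
... | Bézout.+- x y 1+ym≡xa = b ℕ.* x , witness 0 (b ℕ.* y) (begin
  b ℕ.* x ℕ.* a ℕ.+ 0 ℕ.* m  ≡⟨ lhs b x a m ⟩
  b ℕ.* (x ℕ.* a)            ≡⟨ ≡.cong (b ℕ.*_) 1+ym≡xa ⟨
  b ℕ.* (1 ℕ.+ y ℕ.* m)      ≡⟨ rhs b y m ⟩
  b ℕ.+ b ℕ.* y ℕ.* m        ∎)
  where
  open ≡.≡-Reasoning
  lhs : ∀ b x a m → b ℕ.* x ℕ.* a ℕ.+ 0 ℕ.* m ≡ b ℕ.* (x ℕ.* a)
  lhs = ℕ-Solver.solve-∀
  rhs : ∀ b y m → b ℕ.* (1 ℕ.+ y ℕ.* m) ≡ b ℕ.+ b ℕ.* y ℕ.* m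
  rhs = ℕ-Solver.solve-∀
... | Bézout.-+ x y 1+xa≡ym with m
...   | ℕ.zero  = contradiction (≡.trans 1+xa≡ym (ℕ.*-zeroʳ y)) λ ()
...   | ℕ.suc k = b ℕ.* x ℕ.* k , witness b (b ℕ.* k ℕ.* y) (begin
  b ℕ.* x ℕ.* k ℕ.* a ℕ.+ b ℕ.* ℕ.suc k  ≡⟨ lhs b x k a ⟩
  b ℕ.* k ℕ.* (1 ℕ.+ x ℕ.* a) ℕ.+ b      ≡⟨ ≡.cong (λ t → b ℕ.* k ℕ.* t ℕ.+ b) 1+xa≡ym ⟩
  b ℕ.* k ℕ.* (y ℕ.* ℕ.suc k) ℕ.+ b      ≡⟨ rhs b k y ⟩
  b ℕ.+ b ℕ.* k ℕ.* y ℕ.* ℕ.suc k        ∎)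
  where
  open ≡.≡-Reasoning
  lhs : ∀ b x k a → b ℕ.* x ℕ.* k ℕ.* a ℕ.+ b ℕ.* (1 ℕ.+ k) ≡ b ℕ.* k ℕ.* (1 ℕ.+ x ℕ.* a) ℕ.+ b
  lhs = ℕ-Solver.solve-∀
  rhs : ∀ b k y → b ℕ.* k ℕ.* (y ℕ.* (1 ℕ.+ k)) ℕ.+ b ≡ b ℕ.+ b ℕ.* k ℕ.* y ℕ.* (1 ℕ.+ k)
  rhs = ℕ-Solver.solve-∀

-- Congruences in ℤ

module ModularCongruence (m : ℕ) where

  infix 4 _≈ₘ_

  -- A record wrapper around Congr, so that its two sides can be inferred.
  record _≈ₘ_ (a b : ℤ) : Set where
    constructor mkCongr
    field congr : Congr m a b

  open _≈ₘ_ public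

  private
    fromSigned : ∀ {a b} → + m Signed.∣ a ℤ.- b → a ≈ₘ b
    fromSigned m∣a-b = mkCongr (Signed.∣⇒∣ᵤ m∣a-b)

    toSigned : ∀ {a b} → a ≈ₘ b → + m Signed.∣ a ℤ.- b
    toSigned (mkCongr m∣a-b) = Signed.∣ᵤ⇒∣ m∣a-b

    liftSigned : ∀ {x c d} → x ≡ c ℤ.- d → + m Signed.∣ x → c ≈ₘ d
    liftSigned eq m∣x = fromSigned (≡.subst (+ m Signed.∣_) eq m∣x)

  ≈ₘ-by-quotient : ∀ {a b} k → a ℤ.- b ≡ k * + m → a ≈ₘ b
  ≈ₘ-by-quotient k eq = fromSigned (Signed.divides k eq)

  ≈ₘ-reflexive : ∀ {a b} → a ≡ b → a ≈ₘ b
  ≈ₘ-reflexive {a} ≡.refl = ≈ₘ-by-quotient ℤ.0ℤ (lemma a (+ m))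
    where
    lemma : ∀ a m → a ℤ.- a ≡ ℤ.0ℤ * m
    lemma = solve-∀

  ≈ₘ-sym : ∀ {a b} → a ≈ₘ b → b ≈ₘ a
  ≈ₘ-sym {a} {b} a≈b = liftSigned (lemma a b) (Signed.∣m⇒∣-m (toSigned a≈b))
    where
    lemma : ∀ a b → ℤ.- (a ℤ.- b) ≡ b ℤ.- a
    lemma = solve-∀

  ≈ₘ-trans : ∀ {a b c} → a ≈ₘ b → b ≈ₘ c → a ≈ₘ c
  ≈ₘ-trans {a} {b} {c} a≈b b≈c =
    liftSigned (lemma a b c) (Signed.∣m∣n⇒∣m+n (toSigned a≈b) (toSigned b≈c))
    where
    lemma : ∀ a b c → (a ℤ.- b) ℤ.+ (b ℤ.- c) ≡ a ℤ.- c
    lemma = solve-∀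

  ≈ₘ-isEquivalence : IsEquivalence _≈ₘ_
  ≈ₘ-isEquivalence = record
    { refl = ≈ₘ-reflexive ≡.refl ; sym = ≈ₘ-sym ; trans = ≈ₘ-trans }

  ≈ₘ-setoid : Setoid _ _
  ≈ₘ-setoid = record { isEquivalence = ≈ₘ-isEquivalence }

  +-cong : ∀ {a b c d} → a ≈ₘ c → b ≈ₘ d → a ℤ.+ b ≈ₘ c ℤ.+ d
  +-cong {a} {b} {c} {d} a≈c b≈d =
    liftSigned (lemma a b c d) (Signed.∣m∣n⇒∣m+n (toSigned a≈c) (toSigned b≈d))
    where
    lemma : ∀ a b c d → (a ℤ.- c) ℤ.+ (b ℤ.- d) ≡ (a ℤ.+ b) ℤ.- (c ℤ.+ d)
    lemma = solve-∀

  *-congˡ : ∀ k {a b} → a ≈ₘ b → k * a ≈ₘ k * b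
  *-congˡ k {a} {b} a≈b = liftSigned (lemma k a b) (Signed.∣n⇒∣m*n k (toSigned a≈b))
    where
    lemma : ∀ k a b → k * (a ℤ.- b) ≡ k * a ℤ.- k * b
    lemma = solve-∀

  *-congʳ : ∀ k {a b} → a ≈ₘ b → a * k ≈ₘ b * k
  *-congʳ k {a} {b} a≈b = liftSigned (lemma k a b) (Signed.∣m⇒∣m*n k (toSigned a≈b))
    where
    lemma : ∀ k a b → (a ℤ.- b) * k ≡ a * k ℤ.- b * k
    lemma = solve-∀

  +-multiple : ∀ a k → a ℤ.+ k * + m ≈ₘ a
  +-multiple a k = ≈ₘ-by-quotient k (lemma a k (+ m))
    where
    lemma : ∀ a k m → (a ℤ.+ k * m) ℤ.- a ≡ k * m
    lemma = solve-∀

  m*-≈ₘ-0 : ∀ a → + m * a ≈ₘ ℤ.0ℤ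
  m*-≈ₘ-0 a = ≈ₘ-trans (≈ₘ-reflexive (lemma a (+ m))) (+-multiple ℤ.0ℤ a)
    where
    lemma : ∀ a m → m * a ≡ ℤ.0ℤ ℤ.+ a * m
    lemma = solve-∀

  ≡-mod⇒≈ₘ : ∀ {n n′} → n ≡ n′ mod m → + n ≈ₘ + n′
  ≡-mod⇒≈ₘ {n} {n′} (witness q q′ eq) = begin
    + n                        ≈⟨ +-multiple (+ n) (+ q) ⟨
    + n ℤ.+ + q * + m          ≡⟨ pos-+-* n q ⟨
    + (n ℕ.+ q ℕ.* m)          ≡⟨ ≡.cong +_ eq ⟩
    + (n′ ℕ.+ q′ ℕ.* m)        ≡⟨ pos-+-* n′ q′ ⟩
    + n′ ℤ.+ + q′ * + m        ≈⟨ +-multiple (+ n′) (+ q′) ⟩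
    + n′                       ∎
    where
    open import Relation.Binary.Reasoning.Setoid ≈ₘ-setoid
    pos-+-* : ∀ n q → + (n ℕ.+ q ℕ.* m) ≡ + n ℤ.+ + q * + m
    pos-+-* n q = ≡.trans (ℤ.pos-+ n (q ℕ.* m)) (≡.cong (ℤ._+_ (+ n)) (ℤ.pos-* q m))

iter-+ : ∀ {a} {A : Set a} (f : A → A) i j x → iter (i ℕ.+ j) f x ≡ iter i f (iter j f x)
iter-+ f ℕ.zero    j x = ≡.refl
iter-+ f (ℕ.suc i) j x = ≡.cong f (iter-+ f i j x)

iter-commute : ∀ {a} {A : Set a} (f : A → A) n x → iter n f (f x) ≡ f (iter n f x)
iter-commute f ℕ.zero    x = ≡.refl
iter-commute f (ℕ.suc n) x = ≡.cong f (iter-commute f n x)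

-- The action of μ_m and the operators 1 - [ζ]

module ModuleProperties {c ℓ : Level} {m : ℕ} (M : ZmCmModule m c ℓ) where
  open ZmCmModule M
  open import Algebra.Properties.AbelianGroup grp
  open import Algebra.Properties.CommutativeSemigroup commutativeSemigroup using (interchange)
  open import Relation.Binary.Reasoning.Setoid setoid

  module Endomorphism (f : Carrier → Carrier) (f-cong : ∀ {x y} → x ≈ y → f x ≈ f y)
                      (f-hom : ∀ x y → f (x ∙ y) ≈ f x ∙ f y) where

    f-ε : f ε ≈ ε
    f-ε = identityˡ-unique (f ε) (f ε) (trans (sym (f-hom ε ε)) (f-cong (identityˡ ε)))

    f-⁻¹ : ∀ x → f (x ⁻¹) ≈ f x ⁻¹
    f-⁻¹ x = inverseʳ-unique (f x) (f (x ⁻¹))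
      (trans (sym (f-hom x (x ⁻¹))) (trans (f-cong (inverseʳ x)) f-ε))

  act-cong : ∀ k {x y} → x ≈ y → act k x ≈ act k y
  act-cong ℕ.zero    x≈y = x≈y
  act-cong (ℕ.suc k) x≈y = τ-cong (act-cong k x≈y)

  act-hom : ∀ k x y → act k (x ∙ y) ≈ act k x ∙ act k y
  act-hom ℕ.zero    x y = refl
  act-hom (ℕ.suc k) x y = trans (τ-cong (act-hom k x y)) (τ-hom _ _)

  act-+ : ∀ i j x → act (i ℕ.+ j) x ≡ act i (act j x)
  act-+ = iter-+ τ

  act-periodic : ∀ q x → act (q ℕ.* m) x ≈ x
  act-periodic ℕ.zero    x = refl
  act-periodic (ℕ.suc q) x = begin
    act (m ℕ.+ q ℕ.* m) x    ≡⟨ act-+ m (q ℕ.* m) x ⟩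
    act m (act (q ℕ.* m) x)  ≈⟨ act-cong m (act-periodic q x) ⟩
    act m x                  ≈⟨ τ-order x ⟩
    x                        ∎

  act-+-periodic : ∀ n q x → act (n ℕ.+ q ℕ.* m) x ≈ act n x
  act-+-periodic n q x =
    ≡.subst (_≈ act n x) (≡.sym (act-+ n (q ℕ.* m) x)) (act-cong n (act-periodic q x))

  act-≡-mod : ∀ {n n′} → n ≡ n′ mod m → ∀ x → act n x ≈ act n′ x
  act-≡-mod {n} {n′} (witness q q′ eq) x = begin
    act n x                 ≈⟨ act-+-periodic n q x ⟨
    act (n ℕ.+ q ℕ.* m) x    ≡⟨ ≡.cong (λ k → act k x) eq ⟩
    act (n′ ℕ.+ q′ ℕ.* m) x  ≈⟨ act-+-periodic n′ q′ x ⟩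
    act n′ x                ∎

  act-*-fixed : ∀ H h x → act h x ≈ x → act (H ℕ.* h) x ≈ x
  act-*-fixed ℕ.zero    h x fixed = refl
  act-*-fixed (ℕ.suc H) h x fixed = begin
    act (h ℕ.+ H ℕ.* h) x    ≡⟨ act-+ h (H ℕ.* h) x ⟩
    act h (act (H ℕ.* h) x)  ≈⟨ act-cong h (act-*-fixed H h x fixed) ⟩
    act h x                  ≈⟨ fixed ⟩
    x                        ∎

  fixed-≡-mod : ∀ H h {g} → H ℕ.* h ≡ g mod m → ∀ x → act h x ≈ x → act g x ≈ x
  fixed-≡-mod H h H*h≡g x fixed =
    trans (sym (act-≡-mod H*h≡g x)) (act-*-fixed H h x fixed)

  oneMinus-cong : ∀ h {x y} → x ≈ y → oneMinus h x ≈ oneMinus h y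
  oneMinus-cong h x≈y = ∙-cong x≈y (⁻¹-cong (act-cong h x≈y))

  oneMinus-hom : ∀ h x y → oneMinus h (x ∙ y) ≈ oneMinus h x ∙ oneMinus h y
  oneMinus-hom h x y = begin
    (x ∙ y) ∙ act h (x ∙ y) ⁻¹            ≈⟨ ∙-congˡ (⁻¹-cong (act-hom h x y)) ⟩
    (x ∙ y) ∙ (act h x ∙ act h y) ⁻¹      ≈⟨ ∙-congˡ (⁻¹-∙-comm (act h x) (act h y)) ⟨
    (x ∙ y) ∙ (act h x ⁻¹ ∙ act h y ⁻¹)   ≈⟨ interchange x y _ _ ⟩
    oneMinus h x ∙ oneMinus h y           ∎

  module OneMinus h = Endomorphism (oneMinus h) (oneMinus-cong h) (oneMinus-hom h)

  oneMinus-τ : ∀ h x → oneMinus h (τ x) ≈ τ (oneMinus h x)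
  oneMinus-τ h x = begin
    τ x ∙ act h (τ x) ⁻¹    ≡⟨ ≡.cong (λ y → τ x ∙ y ⁻¹) (iter-commute τ h x) ⟩
    τ x ∙ τ (act h x) ⁻¹    ≈⟨ ∙-congˡ (τ-⁻¹ (act h x)) ⟨
    τ x ∙ τ (act h x ⁻¹)    ≈⟨ τ-hom x _ ⟨
    τ (oneMinus h x)        ∎
    where open Endomorphism τ τ-cong τ-hom renaming (f-⁻¹ to τ-⁻¹)

  ·-cong : ∀ k {x y} → x ≈ y → k · x ≈ k · y
  ·-cong ℕ.zero    x≈y = refl
  ·-cong (ℕ.suc k) x≈y = ∙-cong x≈y (·-cong k x≈y)

  oneMinus-· : ∀ h k x → oneMinus h (k · x) ≈ k · oneMinus h x
  oneMinus-· h ℕ.zero    x = OneMinus.f-ε h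
  oneMinus-· h (ℕ.suc k) x = trans (oneMinus-hom h x (k · x)) (∙-congˡ (oneMinus-· h k x))

  oneMinus-≡-mod : ∀ {n n′} → n ≡ n′ mod m → ∀ x → oneMinus n x ≈ oneMinus n′ x
  oneMinus-≡-mod n≡n′ x = ∙-congˡ (⁻¹-cong (act-≡-mod n≡n′ x))

  oneMinus-≈⇒fixed : ∀ h {x y} → oneMinus h x ≈ oneMinus h y → act h (x - y) ≈ x - y
  oneMinus-≈⇒fixed h {x} {y} eq = sym (x∙y⁻¹≈ε⇒x≈y (x - y) (act h (x - y)) (begin
    oneMinus h (x ∙ y ⁻¹)              ≈⟨ oneMinus-hom h x (y ⁻¹) ⟩
    oneMinus h x ∙ oneMinus h (y ⁻¹)   ≈⟨ ∙-congˡ (OneMinus.f-⁻¹ h y) ⟩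
    oneMinus h x ∙ oneMinus h y ⁻¹     ≈⟨ x≈y⇒x∙y⁻¹≈ε eq ⟩
    ε                                  ∎))

  orbitSum : (ℕ → ℕ) → ℕ → Carrier → Carrier
  orbitSum e ℕ.zero    x = ε
  orbitSum e (ℕ.suc k) x = orbitSum e k x ∙ act (e k) x

  normSum≡orbitSum : ∀ k x → normSum k x ≡ orbitSum (λ i → i) k x
  normSum≡orbitSum ℕ.zero    x = ≡.refl
  normSum≡orbitSum (ℕ.suc k) x = ≡.cong (_∙ act k x) (normSum≡orbitSum k x)

  geometricSum : ℕ → ℕ → Carrier → Carrier
  geometricSum h = orbitSum (ℕ._* h)

  oneMinus-geometricSum : ∀ h H x → oneMinus h (geometricSum h H x) ≈ oneMinus (H ℕ.* h) x
  oneMinus-geometricSum h ℕ.zero    x = trans (OneMinus.f-ε h) (sym (inverseʳ x))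
  oneMinus-geometricSum h (ℕ.suc H) x = begin
    oneMinus h (geometricSum h H x ∙ y)                 ≈⟨ oneMinus-hom h _ y ⟩
    oneMinus h (geometricSum h H x) ∙ oneMinus h y      ≈⟨ ∙-congʳ (oneMinus-geometricSum h H x) ⟩
    (x - y) ∙ (y - act h y)                             ≡⟨ ≡.cong (λ z → (x - y) ∙ (y - z)) (act-+ h (H ℕ.* h) x) ⟨
    (x - y) ∙ (y - act (h ℕ.+ H ℕ.* h) x)               ≈⟨ telescope x y _ ⟩
    x - act (h ℕ.+ H ℕ.* h) x                           ∎
    where
    y : Carrier
    y = act (H ℕ.* h) x
    telescope : ∀ a b d → (a - b) ∙ (b - d) ≈ a - d
    telescope a b d = begin
      (a ∙ b ⁻¹) ∙ (b ∙ d ⁻¹)  ≈⟨ interchange a _ b _ ⟩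
      (a ∙ b) ∙ (b ⁻¹ ∙ d ⁻¹)  ≈⟨ ∙-congʳ (comm a b) ⟩
      (b ∙ a) ∙ (b ⁻¹ ∙ d ⁻¹)  ≈⟨ interchange b a _ _ ⟩
      (b ∙ b ⁻¹) ∙ (a ∙ d ⁻¹)  ≈⟨ ∙-congʳ (inverseʳ b) ⟩
      ε ∙ (a ∙ d ⁻¹)           ≈⟨ identityˡ _ ⟩
      a ∙ d ⁻¹                 ∎

  oneMinus-≡-mod-geometricSum : ∀ H h {g} → H ℕ.* h ≡ g mod m → ∀ x →
                                 oneMinus h (geometricSum h H x) ≈ oneMinus g x
  oneMinus-≡-mod-geometricSum H h H*h≡g x =
    trans (oneMinus-geometricSum h H x) (oneMinus-≡-mod H*h≡g x)

  oneMinus-image-⊆ : ∀ H h {g} → H ℕ.* h ≡ g mod m →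
                     ∀ x → ∃ λ y → oneMinus g x ≈ oneMinus h y
  oneMinus-image-⊆ H h H*h≡g x =
    geometricSum h H x , sym (oneMinus-≡-mod-geometricSum H h H*h≡g x)

-- Homomorphisms to the trivial module ℤ/m

module TrivHomProperties {c ℓ : Level} {m : ℕ} {M : ZmCmModule m c ℓ} (Φʰ : TrivHom M) where
  open ZmCmModule M
  open ModuleProperties M
  open import Algebra.Properties.AbelianGroup grp using (x≈y⇒x∙y⁻¹≈ε; //-rightDividesˡ)
  open TrivHom Φʰ
  open ModularCongruence m
  open import Relation.Binary.Reasoning.Setoid ≈ₘ-setoid

  Φ-cong′ : ∀ {x y} → x ≈ y → Φ x ≈ₘ Φ y
  Φ-cong′ x≈y = mkCongr (Φ-cong x≈y)

  Φ-hom′ : ∀ x y → Φ (x ∙ y) ≈ₘ Φ x ℤ.+ Φ y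
  Φ-hom′ x y = mkCongr (Φ-hom x y)

  Φ-scalar′ : ∀ k x → Φ (k · x) ≈ₘ + k * Φ x
  Φ-scalar′ k x = mkCongr (Φ-scalar k x)

  Φ-ε : Φ ε ≈ₘ ℤ.0ℤ
  Φ-ε = Φ-scalar′ 0 ε

  Φ-act : ∀ k x → Φ (act k x) ≈ₘ Φ x
  Φ-act ℕ.zero    x = ≈ₘ-reflexive ≡.refl
  Φ-act (ℕ.suc k) x = ≈ₘ-trans (mkCongr (Φ-equiv (act k x))) (Φ-act k x)

  Φ-orbitSum : ∀ e k x → Φ (orbitSum e k x) ≈ₘ + k * Φ x
  Φ-orbitSum e ℕ.zero    x = Φ-ε
  Φ-orbitSum e (ℕ.suc k) x = begin
    Φ (orbitSum e k x ∙ act (e k) x)         ≈⟨ Φ-hom′ _ _ ⟩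
    Φ (orbitSum e k x) ℤ.+ Φ (act (e k) x)   ≈⟨ +-cong (Φ-orbitSum e k x) (Φ-act (e k) x) ⟩
    + k * Φ x ℤ.+ Φ x                        ≡⟨ lemma (+ k) (Φ x) ⟩
    + ℕ.suc k * Φ x                          ∎
    where
    lemma : ∀ k z → k * z ℤ.+ z ≡ (ℤ.1ℤ ℤ.+ k) * z
    lemma = solve-∀

  Φ-N : ∀ x → Φ (N x) ≈ₘ ℤ.0ℤ
  Φ-N x = begin
    Φ (N x)                          ≡⟨ ≡.cong Φ (normSum≡orbitSum m x) ⟩
    Φ (orbitSum (λ i → i) m x)       ≈⟨ Φ-orbitSum _ m x ⟩
    + m * Φ x                        ≈⟨ m*-≈ₘ-0 (Φ x) ⟩
    ℤ.0ℤ                             ∎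

  Φ-fixed : ∀ g → Acyclic M g → ∀ x → act g x ≈ x → Φ x ≈ₘ ℤ.0ℤ
  Φ-fixed g (fixed⇒norm , _) x fixed with fixed⇒norm x (x≈y⇒x∙y⁻¹≈ε (sym fixed))
  ... | y , x≈Ny = ≈ₘ-trans (Φ-cong′ x≈Ny) (Φ-N y)

  Φ-oneMinus-injective : ∀ g h → Acyclic M g → (∀ x → act h x ≈ x → act g x ≈ x) →
                         ∀ {x y} → oneMinus h x ≈ oneMinus h y → Φ x ≈ₘ Φ y
  Φ-oneMinus-injective g h acyclic fixed-h⇒fixed-g {x} {y} eq = begin
    Φ x                    ≈⟨ Φ-cong′ (//-rightDividesˡ y x) ⟨
    Φ ((x - y) ∙ y)        ≈⟨ Φ-hom′ (x - y) y ⟩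
    Φ (x - y) ℤ.+ Φ y      ≈⟨ +-cong (Φ-fixed g acyclic (x - y) fixed) (≈ₘ-reflexive ≡.refl) ⟩
    ℤ.0ℤ ℤ.+ Φ y           ≡⟨ ℤ.+-identityˡ (Φ y) ⟩
    Φ y                    ∎
    where
    fixed : act g (x - y) ≈ x - y
    fixed = fixed-h⇒fixed-g (x - y) (oneMinus-≈⇒fixed h eq)

-- The homomorphism (1 - [ζ])M → μ_m

module Lift {c ℓ : Level} {m : ℕ} (M : ZmCmModule m c ℓ)
            (g : ℕ) (acyclic : Acyclic M g) (Φʰ : TrivHom M) where
  open ZmCmModule M
  open ModuleProperties M
  open TrivHom Φʰ
  open TrivHomProperties Φʰ
  open ModularCongruence m
  open import Relation.Binary.Reasoning.Setoid ≈ₘ-setoid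

  Φ̂ : Image M g → ℤ
  Φ̂ (_ , a , _) = + g * Φ a

  Φ̂-eval : ∀ H h → H ℕ.* h ≡ g mod m →
           ∀ p b → proj₁ p ≈ oneMinus h b → Φ̂ p ≈ₘ + h * Φ b
  Φ̂-eval H h H*h≡g (x , a , x≈[1-ζ]a) b x≈[1-ζʰ]b = begin
    + g * Φ a                    ≈⟨ *-congʳ (Φ a) (≡-mod⇒≈ₘ H*h≡g) ⟨
    + (H ℕ.* h) * Φ a            ≡⟨ ≡.cong (_* Φ a) (ℤ.pos-* H h) ⟩
    + H * + h * Φ a              ≡⟨ lemma (+ H) (+ h) (Φ a) ⟩
    + h * (+ H * Φ a)            ≈⟨ *-congˡ (+ h) Φb≈HΦa ⟨
    + h * Φ b                    ∎
    where
    lemma : ∀ H h z → H * h * z ≡ h * (H * z)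
    lemma = solve-∀
    Φb≈HΦa : Φ b ≈ₘ + H * Φ a
    Φb≈HΦa = ≈ₘ-trans
      (Φ-oneMinus-injective g h acyclic (fixed-≡-mod H h H*h≡g)
        (trans (sym x≈[1-ζʰ]b) (trans x≈[1-ζ]a (sym (oneMinus-≡-mod-geometricSum H h H*h≡g a)))))
      (Φ-orbitSum _ H a)

  Φ̂-eval-self : ∀ p b → proj₁ p ≈ oneMinus g b → Φ̂ p ≈ₘ + g * Φ b
  Φ̂-eval-self = Φ̂-eval 1 g (≡⇒≡-mod m (ℕ.*-identityˡ g))

  Φ̂-on-generators : ∀ a → Φ̂ (oneMinus g a , a , refl) ≈ₘ + g * Φ a
  Φ̂-on-generators a = ≈ₘ-reflexive ≡.refl

  Φ̂-wd : ∀ p q → proj₁ p ≈ proj₁ q → Φ̂ p ≈ₘ Φ̂ q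
  Φ̂-wd p (y , b , y≈[1-ζ]b) p≈q = Φ̂-eval-self p b (trans p≈q y≈[1-ζ]b)

  Φ̂-hom : ∀ p q r → proj₁ r ≈ proj₁ p ∙ proj₁ q → Φ̂ r ≈ₘ Φ̂ p ℤ.+ Φ̂ q
  Φ̂-hom (x , a , x≈[1-ζ]a) (y , b , y≈[1-ζ]b) r r≈x∙y = begin
    Φ̂ r                          ≈⟨ Φ̂-eval-self r (a ∙ b) r≈[1-ζ][a∙b] ⟩
    + g * Φ (a ∙ b)              ≈⟨ *-congˡ (+ g) (Φ-hom′ a b) ⟩
    + g * (Φ a ℤ.+ Φ b)          ≡⟨ ℤ.*-distribˡ-+ (+ g) (Φ a) (Φ b) ⟩
    + g * Φ a ℤ.+ + g * Φ b      ∎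
    where
    r≈[1-ζ][a∙b] : proj₁ r ≈ oneMinus g (a ∙ b)
    r≈[1-ζ][a∙b] = trans r≈x∙y (trans (∙-cong x≈[1-ζ]a y≈[1-ζ]b) (sym (oneMinus-hom g a b)))

  Φ̂-scalar : ∀ k p r → proj₁ r ≈ k · proj₁ p → Φ̂ r ≈ₘ + k * Φ̂ p
  Φ̂-scalar k (x , a , x≈[1-ζ]a) r r≈k·x = begin
    Φ̂ r                  ≈⟨ Φ̂-eval-self r (k · a) r≈[1-ζ][k·a] ⟩
    + g * Φ (k · a)      ≈⟨ *-congˡ (+ g) (Φ-scalar′ k a) ⟩
    + g * (+ k * Φ a)    ≡⟨ lemma (+ g) (+ k) (Φ a) ⟩
    + k * (+ g * Φ a)    ∎
    where
    lemma : ∀ g k z → g * (k * z) ≡ k * (g * z)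
    lemma = solve-∀
    r≈[1-ζ][k·a] : proj₁ r ≈ oneMinus g (k · a)
    r≈[1-ζ][k·a] = trans r≈k·x (trans (·-cong k x≈[1-ζ]a) (sym (oneMinus-· g k a)))

  Φ̂-equiv : ∀ p r → proj₁ r ≈ τ (proj₁ p) → Φ̂ r ≈ₘ Φ̂ p
  Φ̂-equiv (x , a , x≈[1-ζ]a) r r≈τx = begin
    Φ̂ r              ≈⟨ Φ̂-eval-self r (τ a) r≈[1-ζ]τa ⟩
    + g * Φ (τ a)    ≈⟨ *-congˡ (+ g) (mkCongr (Φ-equiv a)) ⟩
    + g * Φ a        ∎
    where
    r≈[1-ζ]τa : proj₁ r ≈ oneMinus g (τ a)
    r≈[1-ζ]τa = trans r≈τx (trans (τ-cong x≈[1-ζ]a) (sym (oneMinus-τ g a)))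

  Φ̂-isModHom : IsModHom M g Φ̂
  Φ̂-isModHom = record
    { wd     = λ p q p≈q → congr (Φ̂-wd p q p≈q)
    ; hom    = λ p q r eq → congr (Φ̂-hom p q r eq)
    ; scalar = λ k p r eq → congr (Φ̂-scalar k p r eq)
    ; equiv  = λ p r eq → congr (Φ̂-equiv p r eq)
    }

mainTheorem1 : ∀ {c ℓ : Level} (m : ℕ) → 2 ≤ m → (M : ZmCmModule m c ℓ)
  → (g : ℕ) → Coprime g m → Acyclic M g → (Φ : TrivHom M)
  → Σ (Image M g → ℤ) λ Φ̂ →
      IsModHom M g Φ̂
      × (∀ a → Congr m (Φ̂ (ZmCmModule.oneMinus M g a , a , ZmCmModule.refl M)) (+ g * TrivHom.Φ Φ a))
      × (∀ (g′ : ℕ) → Coprime g′ m →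
           (∀ a → ∃ λ b → ZmCmModule._≈_ M (ZmCmModule.oneMinus M g a) (ZmCmModule.oneMinus M g′ b))
           × (∀ a → ∃ λ b → ZmCmModule._≈_ M (ZmCmModule.oneMinus M g′ a) (ZmCmModule.oneMinus M g b))
           × (∀ (p : Image M g) a′ → ZmCmModule._≈_ M (proj₁ p) (ZmCmModule.oneMinus M g′ a′)
                → Congr m (Φ̂ p) (+ g′ * TrivHom.Φ Φ a′)))
mainTheorem1 m _ M g g⊥m acyclic Φʰ =
  Φ̂ , Φ̂-isModHom , (λ a → congr (Φ̂-on-generators a)) , λ g′ g′⊥m →
    let (H , H*g′≡g) = coprime⇒solvable g′⊥m g
        (H′ , H′*g≡g′) = coprime⇒solvable g⊥m g′
    in oneMinus-image-⊆ H g′ H*g′≡g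
     , oneMinus-image-⊆ H′ g H′*g≡g′
     , λ p a′ p≈[1-ζ′]a′ → congr (Φ̂-eval H g′ H*g′≡g p a′ p≈[1-ζ′]a′)
  where
  open ModuleProperties M using (oneMinus-image-⊆)
  open ModularCongruence m using (congr)
  open Lift M g acyclic Φʰ
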